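{- For every cubic bridgeless graph $G$, $m_2(G)\ge \tfrac{5}{12}\, m_4(G)+\tfrac{7}{36}$.
   Context: A cubic bridgeless graph is a graph in which every vertex has degree 3 and each connected component is 2-edge-connected. A perfect matching of $G$ is a set of edges such that every vertex is incident to exactly one of them. For a cubic bridgeless graph $G$ and a positive integer $t$, $m_t(G)$ denotes the maximum, over all choices of $t$ perfect matchings $M_1,\dots,M_t$ of $G$, of $|M_1\cup\dots\cup M_t|/|E(G)|$. -}

module Defs where

open import Data.Nat using (ℕ; suc; _+_; _*_; _≤_)
open import Data.Fin using (Fin)
open import Data.Fin.Properties using (_≟_)
open import Data.Fin.Subset using (Subset; _∩_; _∪_; ∣_∣; ⊥)
open import Data.Product using (_×_; _,_; proj₁; proj₂; ∃)
open import Data.Sum using (_⊎_)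
open import Data.Vec using (Vec; tabulate; foldr′; _∷_; [])
open import Relation.Binary.PropositionalEquality using (_≡_)
open import Relation.Nullary using (¬_; Dec)
open import Relation.Nullary.Decidable using (isYes; _⊎-dec_)

record Graph : Set where
  field
    n    : ℕ
    m    : ℕ
    ends : Fin m → Fin n × Fin n
    loopless : (e : Fin m) → ¬ (proj₁ (ends e) ≡ proj₂ (ends e))
open Graph public

EdgeSet : Graph → Set
EdgeSet G = Subset (m G)

Incident : (G : Graph) → Fin (m G) → Fin (n G) → Set
Incident G e v = (proj₁ (ends G e) ≡ v) ⊎ (proj₂ (ends G e) ≡ v)

incident? : (G : Graph) (e : Fin (m G)) (v : Fin (n G)) → Dec (Incident G e v)
incident? G e v = (proj₁ (ends G e) ≟ v) ⊎-dec (proj₂ (ends G e) ≟ v)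

δ : (G : Graph) → Fin (n G) → EdgeSet G
δ G v = tabulate (λ e → isYes (incident? G e v))

degree : (G : Graph) → Fin (n G) → ℕ
degree G v = ∣ δ G v ∣

Cubic : Graph → Set
Cubic G = (v : Fin (n G)) → degree G v ≡ 3

data ReachAvoiding (G : Graph) (e : Fin (m G)) : Fin (n G) → Fin (n G) → Set where
  here : ∀ {u} → ReachAvoiding G e u u
  step : ∀ {u w} (f : Fin (m G)) → ¬ (f ≡ e) →
         ((proj₁ (ends G f) ≡ u × proj₂ (ends G f) ≡ w) ⊎
          (proj₂ (ends G f) ≡ u × proj₁ (ends G f) ≡ w)) →
         ∀ {z} → ReachAvoiding G e w z → ReachAvoiding G e u z

IsBridge : (G : Graph) → Fin (m G) → Set
IsBridge G e = ¬ ReachAvoiding G e (proj₁ (ends G e)) (proj₂ (ends G e))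

Bridgeless : Graph → Set
Bridgeless G = (e : Fin (m G)) → ¬ IsBridge G e

PerfectMatching : (G : Graph) → EdgeSet G → Set
PerfectMatching G M = (v : Fin (n G)) → ∣ M ∩ δ G v ∣ ≡ 1

AllPerfect : (G : Graph) {t : ℕ} → Vec (EdgeSet G) t → Set
AllPerfect G [] = Data.Unit.⊤ where import Data.Unit
AllPerfect G (M ∷ Ms) = PerfectMatching G M × AllPerfect G Ms

unionSize : (G : Graph) {t : ℕ} → Vec (EdgeSet G) t → ℕ
unionSize G Ms = ∣ foldr′ _∪_ ⊥ Ms ∣

-- m_t(G) is the maximum of unionSize/|E| over t-tuples of perfect matchings.
-- "m_s(G) ≥ (a/d)·m_t(G) + b/d" (with a, b, d natural, d > 0) unfolds, after
-- multiplying by d·|E|, to: for every t-tuple Ns of perfect matchings there is an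
-- s-tuple Ms of perfect matchings with  a·|∪Ns| + b·|E| ≤ d·|∪Ms|.
MGeq : (G : Graph) (s : ℕ) (a b d : ℕ) (t : ℕ) → Set
MGeq G s a b d t =
  (Ns : Vec (EdgeSet G) t) → AllPerfect G Ns →
  ∃ λ (Ms : Vec (EdgeSet G) s) → AllPerfect G Ms ×
    (a * unionSize G Ns + b * m G ≤ d * unionSize G Ms)

{-# OPTIONS --safe #-}
-- Let M₁, …, M₄ be perfect matchings and call the multiplicity of an edge the number of Mᵢ containing it.
-- Counting edge by edge, 60 |⋃ Mᵢ| + 21 ∑ |Mᵢ| and 24 ∑_{i<j} |Mᵢ ∪ Mⱼ| differ only by a deficit of 9 for
-- each edge of multiplicity 1 against a surplus of 18 or 21 for each edge of multiplicity 2 or 3.  At a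
-- vertex the four matchings use at most three edges, so the multiplicities there form a partition of 4
-- into at most three parts, and in each such partition the surplus covers the deficit.  Summing over the
-- vertices (each edge is counted twice) gives 60 |⋃ Mᵢ| + 21 ∑ |Mᵢ| ≤ 24 ∑_{i<j} |Mᵢ ∪ Mⱼ|.  In a cubic
-- graph |Mᵢ| = |E|/3, so the six pairwise unions have average size at least (15 |⋃ Mᵢ| + 7 |E|) / 36,
-- and the largest of them does at least as well.
module Submission where

open import Data.Bool using (Bool; true; false; _∧_; _∨_)
open import Data.Fin using (Fin; zero; suc)
open import Data.Fin.Patterns using (0F; 1F; 2F; 3F; 4F; 5F)
open import Data.Fin.Properties using (_≟_; any?)
open import Data.Fin.Subset using (Subset; _∩_; _∪_; ∣_∣; ⊥)
open import Data.Fin.Subset.Properties using (∩-comm)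
open import Data.Nat using (ℕ; zero; suc; _+_; _*_; _≤_; _<_; _≤?_; _≡ᵇ_; z≤n; s≤s)
open import Data.Nat.Properties hiding (_≟_)
open import Data.Nat.Tactic.RingSolver using (solve-∀)
open import Data.Product using (_×_; _,_; proj₁; proj₂; ∃)
open import Data.Unit using (tt)
open import Data.Vec using (Vec; []; _∷_; lookup; map; foldr′)
open import Data.Vec.Properties using (lookup-map; lookup-zipWith; lookup-replicate; lookup∘tabulate)
open import Function using (_∘_)
open import Relation.Binary.PropositionalEquality using (_≡_; refl; sym; trans; cong; cong₂; subst; module ≡-Reasoning)
open import Relation.Nullary using (yes; no; ¬_; contradiction)
open import Relation.Nullary.Decidable using (isYes; _⊎-dec_; ⌊⌋-map′)
open import Algebra.Properties.Semiring.Sum +-*-semiring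
  using (sum-syntax; sum-cong-≗; sum-replicate-zero; ∑-distrib-+; ∑-comm; *-distribˡ-sum; *-distribʳ-sum)

open import Defs

bit : Bool → ℕ
bit true  = 1
bit false = 0

bit≤1 : ∀ b → bit b ≤ 1
bit≤1 true  = ≤-refl
bit≤1 false = z≤n

bit-∧ : ∀ a b → bit (a ∧ b) ≡ bit a * bit b
bit-∧ true  true  = refl
bit-∧ true  false = refl
bit-∧ false _     = refl

bit-*-natural : (w : ℕ → ℕ) → w 0 ≡ 0 → ∀ b n → w (bit b * n) ≡ bit b * w n
bit-*-natural w w0≡0 false n = w0≡0
bit-*-natural w w0≡0 true  n = trans (cong w (*-identityˡ n)) (sym (*-identityˡ (w n)))

bit-*-≡ᵇ1 : ∀ b n → bit (bit b * n ≡ᵇ 1) ≤ bit b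
bit-*-≡ᵇ1 false n = z≤n
bit-*-≡ᵇ1 true  n = bit≤1 (1 * n ≡ᵇ 1)

∑-const : ∀ k c → ∑[ i < k ] c ≡ k * c
∑-const zero    c = refl
∑-const (suc k) c = cong (c +_) (∑-const k c)

∑-mono-≤ : ∀ {k} {f g : Fin k → ℕ} → (∀ i → f i ≤ g i) → ∑[ i < k ] f i ≤ ∑[ i < k ] g i
∑-mono-≤ {zero}  _   = z≤n
∑-mono-≤ {suc k} f≤g = +-mono-≤ (f≤g zero) (∑-mono-≤ (f≤g ∘ suc))

∑-mono-< : ∀ {k} {f g : Fin (suc k) → ℕ} → (∀ i → f i < g i) →
           ∑[ i < suc k ] f i < ∑[ i < suc k ] g i
∑-mono-< f<g = +-mono-<-≤ (f<g zero) (∑-mono-≤ (<⇒≤ ∘ f<g ∘ suc))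

term≤∑ : ∀ {k} (f : Fin k → ℕ) i → f i ≤ ∑[ j < k ] f j
term≤∑ f zero    = m≤m+n _ _
term≤∑ f (suc i) = ≤-trans (term≤∑ (f ∘ suc) i) (m≤n+m _ (f zero))

∑-≟ : ∀ {k} (a : Fin k) → ∑[ v < k ] bit (isYes (a ≟ v)) ≡ 1
∑-≟ {suc k} zero    = cong suc (sum-replicate-zero k)
∑-≟ {suc k} (suc a) = trans (sum-cong-≗ (λ v → cong bit (⌊⌋-map′ _ _ (a ≟ v)))) (∑-≟ a)

∃-≥-average : ∀ {k} X (a : Fin (suc k) → ℕ) → X ≤ ∑[ i < suc k ] a i →
              ∃ λ i → X ≤ suc k * a i
∃-≥-average {k} X a X≤∑ with any? (λ i → X ≤? suc k * a i)
... | yes found = found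
... | no  none  = contradiction (*-monoʳ-≤ (suc k) X≤∑) (<⇒≱ below)
  where
  open ≤-Reasoning
  below : suc k * ∑[ i < suc k ] a i < suc k * X
  below = begin-strict
    suc k * ∑[ i < suc k ] a i   ≡⟨ *-distribˡ-sum (suc k) a ⟩
    ∑[ i < suc k ] (suc k * a i) <⟨ ∑-mono-< (λ i → ≰⇒> (λ X≤ → none (i , X≤))) ⟩
    ∑[ i < suc k ] X             ≡⟨ ∑-const (suc k) X ⟩
    suc k * X                    ∎

∣p∣≡∑ : ∀ {k} (p : Subset k) → ∣ p ∣ ≡ ∑[ i < k ] bit (lookup p i)
∣p∣≡∑ []          = refl
∣p∣≡∑ (true ∷ p)  = cong suc (∣p∣≡∑ p)
∣p∣≡∑ (false ∷ p) = ∣p∣≡∑ p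

∣p∩q∣≡∑ : ∀ {k} (p q : Subset k) → ∣ p ∩ q ∣ ≡ ∑[ i < k ] (bit (lookup p i) * bit (lookup q i))
∣p∩q∣≡∑ p q = trans (∣p∣≡∑ (p ∩ q))
  (sum-cong-≗ λ i → trans (cong bit (lookup-zipWith _∧_ i p q)) (bit-∧ (lookup p i) (lookup q i)))

⋁ : ∀ {t} → Vec Bool t → Bool
⋁ = foldr′ _∨_ false

⋃ : ∀ {k t} → Vec (Subset k) t → Subset k
⋃ = foldr′ _∪_ ⊥

profile : ∀ {k t} → Vec (Subset k) t → Fin k → Subset t
profile Ms e = map (λ M → lookup M e) Ms

lookup-⋃ : ∀ {k t} (Ms : Vec (Subset k) t) e → lookup (⋃ Ms) e ≡ ⋁ (profile Ms e)
lookup-⋃ []       e = lookup-replicate e false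
lookup-⋃ (M ∷ Ms) e = trans (lookup-zipWith _∨_ e M (⋃ Ms)) (cong (lookup M e ∨_) (lookup-⋃ Ms e))

∣⋃∣≡∑ : ∀ {k t} (Ms : Vec (Subset k) t) → ∣ ⋃ Ms ∣ ≡ ∑[ e < k ] bit (⋁ (profile Ms e))
∣⋃∣≡∑ Ms = trans (∣p∣≡∑ (⋃ Ms)) (sum-cong-≗ (cong bit ∘ lookup-⋃ Ms))

∣profile∣≡∑ : ∀ {k t} (Ms : Vec (Subset k) t) e →
              ∣ profile Ms e ∣ ≡ ∑[ i < t ] bit (lookup (lookup Ms i) e)
∣profile∣≡∑ Ms e = trans (∣p∣≡∑ (profile Ms e)) (sum-cong-≗ λ i → cong bit (lookup-map i _ Ms))

∑-∣profile∣ : ∀ {k t} (Ms : Vec (Subset k) t) →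
              ∑[ e < k ] ∣ profile Ms e ∣ ≡ ∑[ i < t ] ∣ lookup Ms i ∣
∑-∣profile∣ Ms = trans (sum-cong-≗ (∣profile∣≡∑ Ms))
  (trans (∑-comm (λ e i → bit (lookup (lookup Ms i) e)))
         (sum-cong-≗ λ i → sym (∣p∣≡∑ (lookup Ms i))))

∑-*-∣profile∣ : ∀ {k t} (f : Fin k → ℕ) (Ms : Vec (Subset k) t) →
                ∑[ e < k ] (f e * ∣ profile Ms e ∣)
                  ≡ ∑[ i < t ] ∑[ e < k ] (f e * bit (lookup (lookup Ms i) e))
∑-*-∣profile∣ f Ms = trans
  (sum-cong-≗ λ e → trans (cong (f e *_) (∣profile∣≡∑ Ms e)) (*-distribˡ-sum (f e) (λ i → bit (lookup (lookup Ms i) e))))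
  (∑-comm (λ e i → f e * bit (lookup (lookup Ms i) e)))

deficit : ℕ → ℕ
deficit n = 9 * bit (n ≡ᵇ 1)

surplus : ℕ → ℕ
surplus n = 18 * bit (n ≡ᵇ 2) + 21 * bit (n ≡ᵇ 3)

pairs : Fin 6 → Fin 4 × Fin 4
pairs 0F = 0F , 1F
pairs 1F = 0F , 2F
pairs 2F = 0F , 3F
pairs 3F = 1F , 2F
pairs 4F = 1F , 3F
pairs 5F = 2F , 3F

pairOf : ∀ {a} {A : Set a} → Vec A 4 → Fin 6 → Vec A 2
pairOf xs p = lookup xs (proj₁ (pairs p)) ∷ lookup xs (proj₂ (pairs p)) ∷ []

map-pairOf : ∀ {a b} {A : Set a} {B : Set b} (f : A → B) xs p → map f (pairOf xs p) ≡ pairOf (map f xs) p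
map-pairOf f xs p =
  cong₂ _∷_ (sym (lookup-map (proj₁ (pairs p)) f xs)) (cong (_∷ []) (sym (lookup-map (proj₂ (pairs p)) f xs)))

edge-balance : (x : Subset 4) →
  60 * bit (⋁ x) + 21 * ∣ x ∣ + surplus ∣ x ∣ ≡ 24 * ∑[ p < 6 ] bit (⋁ (pairOf x p)) + deficit ∣ x ∣
edge-balance (true  ∷ true  ∷ true  ∷ true  ∷ []) = refl
edge-balance (true  ∷ true  ∷ true  ∷ false ∷ []) = refl
edge-balance (true  ∷ true  ∷ false ∷ true  ∷ []) = refl
edge-balance (true  ∷ true  ∷ false ∷ false ∷ []) = refl
edge-balance (true  ∷ false ∷ true  ∷ true  ∷ []) = refl
edge-balance (true  ∷ false ∷ true  ∷ false ∷ []) = refl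
edge-balance (true  ∷ false ∷ false ∷ true  ∷ []) = refl
edge-balance (true  ∷ false ∷ false ∷ false ∷ []) = refl
edge-balance (false ∷ true  ∷ true  ∷ true  ∷ []) = refl
edge-balance (false ∷ true  ∷ true  ∷ false ∷ []) = refl
edge-balance (false ∷ true  ∷ false ∷ true  ∷ []) = refl
edge-balance (false ∷ true  ∷ false ∷ false ∷ []) = refl
edge-balance (false ∷ false ∷ true  ∷ true  ∷ []) = refl
edge-balance (false ∷ false ∷ true  ∷ false ∷ []) = refl
edge-balance (false ∷ false ∷ false ∷ true  ∷ []) = refl
edge-balance (false ∷ false ∷ false ∷ false ∷ []) = refl

balance-sum : ∀ {k} (Ms : Vec (Subset k) 4) →
  60 * ∣ ⋃ Ms ∣ + 21 * ∑[ i < 4 ] ∣ lookup Ms i ∣ + ∑[ e < k ] surplus ∣ profile Ms e ∣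
    ≡ 24 * ∑[ p < 6 ] ∣ ⋃ (pairOf Ms p) ∣ + ∑[ e < k ] deficit ∣ profile Ms e ∣
balance-sum {k} Ms = begin
  60 * ∣ ⋃ Ms ∣ + 21 * ∑[ i < 4 ] ∣ lookup Ms i ∣ + ∑[ e < k ] surplus (μ e)
    ≡⟨ cong₂ (λ u K → 60 * u + 21 * K + ∑[ e < k ] surplus (μ e)) (∣⋃∣≡∑ Ms) (sym (∑-∣profile∣ Ms)) ⟩
  60 * ∑[ e < k ] covered e + 21 * ∑[ e < k ] μ e + ∑[ e < k ] surplus (μ e)
    ≡⟨ cong₂ (λ u K → u + K + ∑[ e < k ] surplus (μ e)) (*-distribˡ-sum 60 covered) (*-distribˡ-sum 21 μ) ⟩
  ∑[ e < k ] (60 * covered e) + ∑[ e < k ] (21 * μ e) + ∑[ e < k ] surplus (μ e)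
    ≡⟨ trans (∑-distrib-+ (λ e → 60 * covered e + 21 * μ e) (surplus ∘ μ))
             (cong (_+ ∑[ e < k ] surplus (μ e)) (∑-distrib-+ (λ e → 60 * covered e) (λ e → 21 * μ e))) ⟨
  ∑[ e < k ] (60 * covered e + 21 * μ e + surplus (μ e))
    ≡⟨ sum-cong-≗ (edge-balance ∘ profile Ms) ⟩
  ∑[ e < k ] (24 * pairs-covering e + deficit (μ e))
    ≡⟨ ∑-distrib-+ (λ e → 24 * pairs-covering e) (deficit ∘ μ) ⟩
  ∑[ e < k ] (24 * pairs-covering e) + ∑[ e < k ] deficit (μ e)
    ≡⟨ cong (_+ ∑[ e < k ] deficit (μ e)) (trans (sym (*-distribˡ-sum 24 pairs-covering)) (cong (24 *_) pairs-sum)) ⟩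
  24 * ∑[ p < 6 ] ∣ ⋃ (pairOf Ms p) ∣ + ∑[ e < k ] deficit (μ e)
    ∎
  where
  open ≡-Reasoning
  μ covered pairs-covering : Fin k → ℕ
  μ e = ∣ profile Ms e ∣
  covered e = bit (⋁ (profile Ms e))
  pairs-covering e = ∑[ p < 6 ] bit (⋁ (pairOf (profile Ms e) p))
  pairs-sum : ∑[ e < k ] pairs-covering e ≡ ∑[ p < 6 ] ∣ ⋃ (pairOf Ms p) ∣
  pairs-sum = trans (∑-comm (λ e p → bit (⋁ (pairOf (profile Ms e) p)))) (sum-cong-≗ λ p →
    sym (trans (∣⋃∣≡∑ (pairOf Ms p)) (sum-cong-≗ λ e → cong (bit ∘ ⋁) (map-pairOf (λ M → lookup M e) Ms p))))

value-decomposition : ∀ {n} → n ≤ 4 →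
  n ≡ bit (n ≡ᵇ 1) + 2 * bit (n ≡ᵇ 2) + 3 * bit (n ≡ᵇ 3) + 4 * bit (n ≡ᵇ 4)
value-decomposition {0} _ = refl
value-decomposition {1} _ = refl
value-decomposition {2} _ = refl
value-decomposition {3} _ = refl
value-decomposition {4} _ = refl
value-decomposition {suc (suc (suc (suc (suc _))))} (s≤s (s≤s (s≤s (s≤s ()))))

some-value-repeated : ∀ a b c d → a + 2 * b + 3 * c + 4 * d ≡ 4 → a ≤ 3 → 1 ≤ b + c + d
some-value-repeated a (suc b) c       d       _     _   = s≤s z≤n
some-value-repeated a zero    (suc c) d       _     _   = s≤s z≤n
some-value-repeated a zero    zero    (suc d) _     _   = s≤s z≤n
some-value-repeated a zero    zero    zero    total a≤3 =
  contradiction (subst (_≤ 3) (trans (sym a+0+0+0≡a) total) a≤3) (<-irrefl refl)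
  where
  a+0+0+0≡a : a + 0 + 0 + 0 ≡ a
  a+0+0+0≡a = trans (+-identityʳ _) (trans (+-identityʳ _) (+-identityʳ a))

partition-bound : ∀ a b c d → a + 2 * b + 3 * c + 4 * d ≡ 4 → a ≤ 3 → 9 * a ≤ 18 * b + 21 * c
partition-bound a b c d total a≤3 =
  +-cancelʳ-≤ (18 * b + 27 * c + 36 * d) (9 * a) (18 * b + 21 * c) (begin
    9 * a + (18 * b + 27 * c + 36 * d)            ≡⟨ scale a b c d ⟩
    9 * (a + 2 * b + 3 * c + 4 * d)               ≡⟨ cong (9 *_) total ⟩
    36                                            ≤⟨ *-monoʳ-≤ 36 (some-value-repeated a b c d total a≤3) ⟩
    36 * (b + c + d)                              ≤⟨ m≤m+n _ (12 * c) ⟩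
    36 * (b + c + d) + 12 * c                     ≡⟨ regroup b c d ⟩
    18 * b + 21 * c + (18 * b + 27 * c + 36 * d)  ∎)
  where
  open ≤-Reasoning
  scale : ∀ a b c d → 9 * a + (18 * b + 27 * c + 36 * d) ≡ 9 * (a + 2 * b + 3 * c + 4 * d)
  scale = solve-∀
  regroup : ∀ b c d → 36 * (b + c + d) + 12 * c ≡ 18 * b + 21 * c + (18 * b + 27 * c + 36 * d)
  regroup = solve-∀

occurrences : ∀ {k} → (Fin k → ℕ) → ℕ → ℕ
occurrences {k} ν j = ∑[ e < k ] bit (ν e ≡ᵇ j)

∑-by-value : ∀ {k} (ν : Fin k → ℕ) → (∀ e → ν e ≤ 4) →
  ∑[ e < k ] ν e ≡ occurrences ν 1 + 2 * occurrences ν 2 + 3 * occurrences ν 3 + 4 * occurrences ν 4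
∑-by-value {k} ν ν≤4 = trans (sum-cong-≗ (value-decomposition ∘ ν≤4)) (trans
  (∑-distrib-+ (λ e → [ 1 ] e + 2 * [ 2 ] e + 3 * [ 3 ] e) (λ e → 4 * [ 4 ] e))
  (cong₂ _+_
    (trans (∑-distrib-+ (λ e → [ 1 ] e + 2 * [ 2 ] e) (λ e → 3 * [ 3 ] e))
      (cong₂ _+_
        (trans (∑-distrib-+ [ 1 ] (λ e → 2 * [ 2 ] e)) (cong (occurrences ν 1 +_) (sym (*-distribˡ-sum 2 [ 2 ]))))
        (sym (*-distribˡ-sum 3 [ 3 ]))))
    (sym (*-distribˡ-sum 4 [ 4 ]))))
  where
  [_] : ℕ → Fin k → ℕ
  [ j ] e = bit (ν e ≡ᵇ j)

star-balance : ∀ {k} (ν : Fin k → ℕ) → ∑[ e < k ] ν e ≡ 4 → occurrences ν 1 ≤ 3 →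
               ∑[ e < k ] deficit (ν e) ≤ ∑[ e < k ] surplus (ν e)
star-balance {k} ν total singles = begin
  ∑[ e < k ] deficit (ν e)                  ≡⟨ *-distribˡ-sum 9 [ 1 ] ⟨
  9 * # 1                                   ≤⟨ partition-bound (# 1) (# 2) (# 3) (# 4) by-value singles ⟩
  18 * # 2 + 21 * # 3                       ≡⟨ cong₂ _+_ (*-distribˡ-sum 18 [ 2 ]) (*-distribˡ-sum 21 [ 3 ]) ⟩
  ∑[ e < k ] (18 * [ 2 ] e) + ∑[ e < k ] (21 * [ 3 ] e)
                                            ≡⟨ ∑-distrib-+ (λ e → 18 * [ 2 ] e) (λ e → 21 * [ 3 ] e) ⟨
  ∑[ e < k ] surplus (ν e)                  ∎
  where
  open ≤-Reasoning
  # : ℕ → ℕ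
  # = occurrences ν
  [_] : ℕ → Fin k → ℕ
  [ j ] e = bit (ν e ≡ᵇ j)
  by-value : # 1 + 2 * # 2 + 3 * # 3 + 4 * # 4 ≡ 4
  by-value = trans (sym (∑-by-value ν (λ e → ≤-trans (term≤∑ ν e) (≤-reflexive total)))) total

isYes-⊎-distinct : ∀ {k} {a b : Fin k} → ¬ a ≡ b → ∀ v →
  bit (isYes ((a ≟ v) ⊎-dec (b ≟ v))) ≡ bit (isYes (a ≟ v)) + bit (isYes (b ≟ v))
isYes-⊎-distinct {a = a} {b} a≢b v with a ≟ v | b ≟ v
... | yes a≡v | yes b≡v = contradiction (trans a≡v (sym b≡v)) a≢b
... | yes _   | no  _   = refl
... | no  _   | yes _   = refl
... | no  _   | no  _   = refl

module _ (G : Graph) where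

  incidence : Fin (n G) → Fin (m G) → ℕ
  incidence v e = bit (lookup (δ G v) e)

  endpoint-count : ∀ e → ∑[ v < n G ] incidence v e ≡ 2
  endpoint-count e = begin
    ∑[ v < n G ] incidence v e
      ≡⟨ sum-cong-≗ (λ v → trans (cong bit (lookup∘tabulate _ e)) (isYes-⊎-distinct (loopless G e) v)) ⟩
    ∑[ v < n G ] (bit (isYes (a ≟ v)) + bit (isYes (b ≟ v)))
      ≡⟨ ∑-distrib-+ (λ v → bit (isYes (a ≟ v))) (λ v → bit (isYes (b ≟ v))) ⟩
    ∑[ v < n G ] bit (isYes (a ≟ v)) + ∑[ v < n G ] bit (isYes (b ≟ v))
      ≡⟨ cong₂ _+_ (∑-≟ a) (∑-≟ b) ⟩
    2 ∎
    where
    open ≡-Reasoning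
    a b : Fin (n G)
    a = proj₁ (ends G e)
    b = proj₂ (ends G e)

  handshake : (f : Fin (m G) → ℕ) →
    ∑[ v < n G ] ∑[ e < m G ] (incidence v e * f e) ≡ 2 * ∑[ e < m G ] f e
  handshake f = begin
    ∑[ v < n G ] ∑[ e < m G ] (incidence v e * f e)  ≡⟨ ∑-comm (λ v e → incidence v e * f e) ⟩
    ∑[ e < m G ] ∑[ v < n G ] (incidence v e * f e)
      ≡⟨ sum-cong-≗ (λ e → sym (*-distribʳ-sum (f e) (λ v → incidence v e))) ⟩
    ∑[ e < m G ] ((∑[ v < n G ] incidence v e) * f e)  ≡⟨ sum-cong-≗ (λ e → cong (_* f e) (endpoint-count e)) ⟩
    ∑[ e < m G ] (2 * f e)                           ≡⟨ *-distribˡ-sum 2 f ⟨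
    2 * ∑[ e < m G ] f e                             ∎
    where open ≡-Reasoning

  lookup-perfect : ∀ {t} {Ms : Vec (EdgeSet G) t} → AllPerfect G Ms → ∀ i → PerfectMatching G (lookup Ms i)
  lookup-perfect {Ms = _ ∷ _} (perfect , _)  zero    = perfect
  lookup-perfect {Ms = _ ∷ _} (_ , perfects) (suc i) = lookup-perfect perfects i

  incident-edges : Cubic G → ∀ v → ∑[ e < m G ] incidence v e ≡ 3
  incident-edges cubic v = trans (sym (∣p∣≡∑ (δ G v))) (cubic v)

  matched-edge : ∀ {M} → PerfectMatching G M → ∀ v → ∑[ e < m G ] (incidence v e * bit (lookup M e)) ≡ 1
  matched-edge {M} perfect v =
    trans (sym (∣p∩q∣≡∑ (δ G v) M)) (trans (cong ∣_∣ (∩-comm (δ G v) M)) (perfect v))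

  perfect-matching-half : ∀ {M} → PerfectMatching G M → 2 * ∣ M ∣ ≡ n G
  perfect-matching-half {M} perfect = begin
    2 * ∣ M ∣                                                  ≡⟨ cong (2 *_) (∣p∣≡∑ M) ⟩
    2 * ∑[ e < m G ] bit (lookup M e)                          ≡⟨ handshake (bit ∘ lookup M) ⟨
    ∑[ v < n G ] ∑[ e < m G ] (incidence v e * bit (lookup M e)) ≡⟨ sum-cong-≗ (matched-edge {M} perfect) ⟩
    ∑[ v < n G ] 1                                             ≡⟨ ∑-const (n G) 1 ⟩
    n G * 1                                                    ≡⟨ *-identityʳ (n G) ⟩
    n G                                                        ∎
    where open ≡-Reasoning

  cubic-edge-count : Cubic G → 2 * m G ≡ 3 * n G
  cubic-edge-count cubic = begin
    2 * m G
      ≡⟨ cong (2 *_) (trans (sym (*-identityʳ (m G))) (sym (∑-const (m G) 1))) ⟩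
    2 * ∑[ e < m G ] 1
      ≡⟨ handshake (λ _ → 1) ⟨
    ∑[ v < n G ] ∑[ e < m G ] (incidence v e * 1)
      ≡⟨ sum-cong-≗ (λ v → trans (sum-cong-≗ (λ e → *-identityʳ (incidence v e))) (incident-edges cubic v)) ⟩
    ∑[ v < n G ] 3                                   ≡⟨ ∑-const (n G) 3 ⟩
    n G * 3                                          ≡⟨ *-comm (n G) 3 ⟩
    3 * n G                                          ∎
    where open ≡-Reasoning

  perfect-matching-third : Cubic G → ∀ {M} → PerfectMatching G M → 3 * ∣ M ∣ ≡ m G
  perfect-matching-third cubic {M} perfect = *-cancelˡ-≡ (3 * ∣ M ∣) (m G) 2 (begin
    2 * (3 * ∣ M ∣)  ≡⟨ trans (sym (*-assoc 2 3 ∣ M ∣)) (*-assoc 3 2 ∣ M ∣) ⟩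
    3 * (2 * ∣ M ∣)  ≡⟨ cong (3 *_) (perfect-matching-half {M} perfect) ⟩
    3 * n G          ≡⟨ cubic-edge-count cubic ⟨
    2 * m G          ∎)
    where open ≡-Reasoning

  matchings-size : Cubic G → ∀ {t} {Ms : Vec (EdgeSet G) t} → AllPerfect G Ms →
                   3 * ∑[ i < t ] ∣ lookup Ms i ∣ ≡ t * m G
  matchings-size cubic {t} {Ms} perfect = begin
    3 * ∑[ i < t ] ∣ lookup Ms i ∣  ≡⟨ *-distribˡ-sum 3 (λ i → ∣ lookup Ms i ∣) ⟩
    ∑[ i < t ] (3 * ∣ lookup Ms i ∣) ≡⟨ sum-cong-≗ (λ i → perfect-matching-third cubic {lookup Ms i} (lookup-perfect perfect i)) ⟩
    ∑[ i < t ] m G                  ≡⟨ ∑-const t (m G) ⟩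
    t * m G                         ∎
    where open ≡-Reasoning

  star-multiplicity : ∀ {t} {Ms : Vec (EdgeSet G) t} → AllPerfect G Ms → ∀ v →
                      ∑[ e < m G ] (incidence v e * ∣ profile Ms e ∣) ≡ t
  star-multiplicity {t} {Ms} perfect v = begin
    ∑[ e < m G ] (incidence v e * ∣ profile Ms e ∣)
      ≡⟨ ∑-*-∣profile∣ (incidence v) Ms ⟩
    ∑[ i < t ] ∑[ e < m G ] (incidence v e * bit (lookup (lookup Ms i) e))
      ≡⟨ sum-cong-≗ (λ i → matched-edge {lookup Ms i} (lookup-perfect perfect i) v) ⟩
    ∑[ i < t ] 1                                                           ≡⟨ ∑-const t 1 ⟩
    t * 1                                                                  ≡⟨ *-identityʳ t ⟩
    t                                                                      ∎
    where open ≡-Reasoning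

  defect-bound : Cubic G → ∀ {Ms : Vec (EdgeSet G) 4} → AllPerfect G Ms →
    ∑[ e < m G ] deficit ∣ profile Ms e ∣ ≤ ∑[ e < m G ] surplus ∣ profile Ms e ∣
  defect-bound cubic {Ms} perfect = *-cancelˡ-≤ 2 (begin
    2 * ∑[ e < m G ] deficit (μ e)                           ≡⟨ handshake (deficit ∘ μ) ⟨
    ∑[ v < n G ] ∑[ e < m G ] (incidence v e * deficit (μ e)) ≡⟨ masked deficit refl ⟨
    ∑[ v < n G ] ∑[ e < m G ] deficit (star v e)
      ≤⟨ ∑-mono-≤ (λ v → star-balance (star v) (star-multiplicity perfect v) (singles v)) ⟩
    ∑[ v < n G ] ∑[ e < m G ] surplus (star v e)              ≡⟨ masked surplus refl ⟩
    ∑[ v < n G ] ∑[ e < m G ] (incidence v e * surplus (μ e)) ≡⟨ handshake (surplus ∘ μ) ⟩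
    2 * ∑[ e < m G ] surplus (μ e)                           ∎)
    where
    open ≤-Reasoning
    μ : Fin (m G) → ℕ
    μ e = ∣ profile Ms e ∣
    star : Fin (n G) → Fin (m G) → ℕ
    star v e = incidence v e * μ e
    masked : ∀ w → w 0 ≡ 0 →
      ∑[ v < n G ] ∑[ e < m G ] w (star v e) ≡ ∑[ v < n G ] ∑[ e < m G ] (incidence v e * w (μ e))
    masked w w0≡0 = sum-cong-≗ λ v → sum-cong-≗ λ e → bit-*-natural w w0≡0 (lookup (δ G v) e) (μ e)
    singles : ∀ v → occurrences (star v) 1 ≤ 3
    singles v = ≤-trans (∑-mono-≤ (λ e → bit-*-≡ᵇ1 (lookup (δ G v) e) (μ e))) (≤-reflexive (incident-edges cubic v))

rescale : ∀ U K M S → 3 * K ≡ 4 * M → 60 * U + 21 * K ≤ 24 * S → 15 * U + 7 * M ≤ 6 * S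
rescale U K M S 3K≡4M bound = *-cancelˡ-≤ 4 (begin
  4 * (15 * U + 7 * M)  ≡⟨ distrib U M ⟩
  60 * U + 7 * (4 * M)  ≡⟨ cong (λ x → 60 * U + 7 * x) 3K≡4M ⟨
  60 * U + 7 * (3 * K)  ≡⟨ cong (60 * U +_) (*-assoc 7 3 K) ⟨
  60 * U + 21 * K       ≤⟨ bound ⟩
  24 * S                ≡⟨ *-assoc 4 6 S ⟩
  4 * (6 * S)           ∎)
  where
  open ≤-Reasoning
  distrib : ∀ U M → 4 * (15 * U + 7 * M) ≡ 60 * U + 7 * (4 * M)
  distrib = solve-∀

pair-unions-bound : ∀ G → Cubic G → ∀ {Ns : Vec (EdgeSet G) 4} → AllPerfect G Ns →
  15 * ∣ ⋃ Ns ∣ + 7 * m G ≤ ∑[ p < 6 ] (6 * ∣ ⋃ (pairOf Ns p) ∣)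
pair-unions-bound G cubic {Ns} perfect = begin
  15 * ∣ ⋃ Ns ∣ + 7 * m G                ≤⟨ rescale ∣ ⋃ Ns ∣ K (m G) S (matchings-size G cubic perfect) weighted ⟩
  6 * S                                  ≡⟨ *-distribˡ-sum 6 (λ p → ∣ ⋃ (pairOf Ns p) ∣) ⟩
  ∑[ p < 6 ] (6 * ∣ ⋃ (pairOf Ns p) ∣)    ∎
  where
  open ≤-Reasoning
  K S D E : ℕ
  K = ∑[ i < 4 ] ∣ lookup Ns i ∣
  S = ∑[ p < 6 ] ∣ ⋃ (pairOf Ns p) ∣
  D = ∑[ e < m G ] deficit ∣ profile Ns e ∣
  E = ∑[ e < m G ] surplus ∣ profile Ns e ∣
  weighted : 60 * ∣ ⋃ Ns ∣ + 21 * K ≤ 24 * S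
  weighted = +-cancelʳ-≤ E (60 * ∣ ⋃ Ns ∣ + 21 * K) (24 * S) (begin
    60 * ∣ ⋃ Ns ∣ + 21 * K + E  ≡⟨ balance-sum Ns ⟩
    24 * S + D                  ≤⟨ +-monoʳ-≤ (24 * S) (defect-bound G cubic perfect) ⟩
    24 * S + E                  ∎)

-- Bridgelessness only guarantees that perfect matchings exist; the bound holds for any four of them.
theorem12 : (G : Graph) → Cubic G → Bridgeless G →
    MGeq G 2 15 7 36 4
theorem12 G cubic _ Ns perfect =
  let p , bound = ∃-≥-average X (λ p → 6 * ∣ ⋃ (pairOf Ns p) ∣) (pair-unions-bound G cubic perfect)
      i , j = pairs p
  in pairOf Ns p , (lookup-perfect G perfect i , lookup-perfect G perfect j , tt) ,
     subst (X ≤_) (sym (*-assoc 6 6 ∣ ⋃ (pairOf Ns p) ∣)) bound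
  where
  X : ℕ
  X = 15 * ∣ ⋃ Ns ∣ + 7 * m G
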